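{- Let $n\ge 4$ and $k\ge 1$ be integers. Then \[ \gamma_{[k]R}(C_5\Box P_n)\le 5(n-2)\left\lceil\frac{k+4}{5}\right\rceil+10\left\lceil\frac{k+3-\left\lceil\frac{k+4}{5}\right\rceil}{3}\right\rceil\le \frac{3nk+27n+2k-2}{3}. \]
   Context: For a graph $G$ and $v\in V(G)$, $N(v)$ is the open neighborhood and $N[v]=N(v)\cup\{v\}$. For an integer $k\ge1$, a function $f:V(G)\to\{0,1,\dots,k+1\}$ is a $[k]$-Roman dominating function if for every vertex $v$ with $f(v)<k$ we have $\sum_{u\in N[v]}f(u)\ge k+|\{u\in N(v): f(u)>0\}|$. The weight of $f$ is $\sum_{v}f(v)$, and $\gamma_{[k]R}(G)$ is the minimum weight of a $[k]$-Roman dominating function on $G$. $C_m\Box P_n$ is the Cartesian product of the cycle $C_m$ (vertices $0,\dots,m-1$ mod $m$) and the path $P_n$ (vertices $0,\dots,n-1$): $(i,j)\sim(i',j')$ iff ($i=i'$ and $|j-j'|=1$) or ($j=j'$ and $i'\equiv i\pm1 \pmod m$). -}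

module Defs where

open import Data.Nat using (ℕ; zero; suc; _+_; _*_; _∸_; _≤_; _<_; _≡ᵇ_; _<ᵇ_; NonZero)
open import Data.Nat.DivMod using (_/_)
open import Data.Fin using (Fin; toℕ)
open import Data.Fin.Properties using (_≟_)
open import Data.Bool using (Bool; true; false; _∧_; _∨_; if_then_else_)
open import Data.List using (List; map; allFin; cartesianProduct)
open import Data.Nat.ListAction using (sum)
open import Data.Product using (_×_; _,_; ∃)
open import Relation.Nullary.Decidable using (⌊_⌋)

-- Vertices of C_m □ P_n : pairs (i , j) with i ∈ Z_m (cycle), j ∈ {0..n-1} (path)
Vertex : ℕ → ℕ → Set
Vertex m n = Fin m × Fin n

pathAdj : ℕ → ℕ → Bool
pathAdj a b = (suc a ≡ᵇ b) ∨ (suc b ≡ᵇ a)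

cycAdj : ℕ → ℕ → ℕ → Bool
cycAdj m a b = pathAdj a b ∨ ((suc a ≡ᵇ m) ∧ (b ≡ᵇ 0)) ∨ ((suc b ≡ᵇ m) ∧ (a ≡ᵇ 0))

adj : ∀ {m n} → Vertex m n → Vertex m n → Bool
adj {m} (i , j) (i' , j') =
  (⌊ i ≟ i' ⌋ ∧ pathAdj (toℕ j) (toℕ j')) ∨ (⌊ j ≟ j' ⌋ ∧ cycAdj m (toℕ i) (toℕ i'))

vertices : (m n : ℕ) → List (Vertex m n)
vertices m n = cartesianProduct (allFin m) (allFin n)

weight : ∀ {m n} → (Vertex m n → ℕ) → ℕ
weight {m} {n} f = sum (map f (vertices m n))

nbSum : ∀ {m n} → (Vertex m n → ℕ) → Vertex m n → ℕ
nbSum {m} {n} f v = sum (map (λ u → if adj v u then f u else 0) (vertices m n))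

nbActive : ∀ {m n} → (Vertex m n → ℕ) → Vertex m n → ℕ
nbActive {m} {n} f v = sum (map (λ u → if adj v u ∧ (0 <ᵇ f u) then 1 else 0) (vertices m n))

IsKRDF : (k m n : ℕ) → (Vertex m n → ℕ) → Set
IsKRDF k m n f =
  (∀ v → f v ≤ suc k) ×
  (∀ v → f v < k → k + nbActive f v ≤ f v + nbSum f v)

-- γ_[k]R(C_m □ P_n) ≤ b  (the minimum weight is at most b iff some [k]-RDF has weight ≤ b)
γ[_]R-C_□P_≤_ : (k m n b : ℕ) → Set
γ[ k ]R-C m □P n ≤ b = ∃ λ (f : Vertex m n → ℕ) → IsKRDF k m n f × weight f ≤ b

⌈_/_⌉ : ℕ → (b : ℕ) → .{{NonZero b}} → ℕ
⌈ a / b ⌉ = (a + b ∸ 1) / b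

bound5 : ℕ → ℕ → ℕ
bound5 n k = 5 * (n ∸ 2) * ⌈ k + 4 / 5 ⌉ + 10 * ⌈ k + 3 ∸ ⌈ k + 4 / 5 ⌉ / 3 ⌉

{-# OPTIONS --safe #-}

-- Give every vertex of column j of C₅ □ P_n the weight b if j is an end of P_n and a otherwise,
-- where a = ⌈(k+4)/5⌉ and b = ⌈(k+3-a)/3⌉; this has weight 5(n-2)a + 10b.  All weights are
-- positive, so the [k]-Roman condition at v reads k + deg v ≤ f(N[v]), and since f is constant
-- on each 5-cycle it depends only on the column: an end column needs 3b + a ≥ k + 3, an inner
-- column 5a ≥ k + 4, or 4a + b ≥ k + 4 next to an end (n ≥ 4 keeps both neighbours of an inner
-- column from being ends).  These, the bounds 0 < a, b ≤ k + 1 and the final estimate all follow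
-- from k + 4 ≤ 5a ≤ k + 8 and k + 3 ≤ 3b + a ≤ k + 5.

module Submission where

open import Data.Bool using (Bool; true; false; _∧_; _∨_; if_then_else_)
open import Data.Bool.Properties using (∧-comm; ∧-zeroʳ; ∧-identityʳ; T-≡)
open import Data.Fin using (Fin; toℕ; zero; suc)
open import Data.Fin.Properties using (_≟_; toℕ<n)
open import Data.List using (List; []; _∷_; _++_; map; tabulate; allFin; cartesianProduct)
open import Data.List.Properties using (map-++; map-∘; map-cong; map-tabulate)
open import Data.Nat hiding (_≟_)
open import Data.Nat.DivMod using (_/_; _%_; m≡m%n+[m/n]*n; m%n<n; m/n*n≤m)
open import Data.Nat.ListAction using (sum)
open import Data.Nat.ListAction.Properties using (sum-++)
open import Data.Nat.Properties hiding (_≟_)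
open import Data.Nat.Tactic.RingSolver using (solve; solve-∀)
open import Data.Product using (_×_; _,_; proj₂)
open import Data.Sum using (inj₁; inj₂)
open import Function using (_∘_; id; Equivalence)
open import Relation.Binary.PropositionalEquality
open import Relation.Nullary.Decidable using (⌊_⌋; yes; no)
open import Algebra.Properties.CommutativeMonoid.Sum +-0-commutativeMonoid
  using (sum-syntax; sum-cong-≗; sum-replicate-zero; ∑-distrib-+)

open import Defs

≤-offset : ∀ {m n} d → m + d ≡ n → m ≤ n
≤-offset {m} d refl = m≤m+n m d

m≤n*⌈m/n⌉ : ∀ m n .{{_ : NonZero n}} → m ≤ n * ⌈ m / n ⌉
m≤n*⌈m/n⌉ m (suc d) = +-cancelʳ-≤ d m (suc d * q) (begin
  m + d                 ≡⟨ +-∸-assoc m {suc d} (s≤s z≤n) ⟨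
  x                     ≡⟨ m≡m%n+[m/n]*n x (suc d) ⟩
  x % suc d + q * suc d ≤⟨ +-monoˡ-≤ (q * suc d) (s≤s⁻¹ (m%n<n x (suc d))) ⟩
  d + q * suc d         ≡⟨ +-comm d (q * suc d) ⟩
  q * suc d + d         ≡⟨ cong (_+ d) (*-comm q (suc d)) ⟩
  suc d * q + d         ∎)
  where
  open ≤-Reasoning
  x q : ℕ
  x = m + suc d ∸ 1
  q = x / suc d

n*⌈m/n⌉≤m+n∸1 : ∀ m n .{{_ : NonZero n}} → n * ⌈ m / n ⌉ ≤ m + n ∸ 1
n*⌈m/n⌉≤m+n∸1 m n = subst (_≤ m + n ∸ 1) (*-comm _ n) (m/n*n≤m (m + n ∸ 1) n)

sum-tabulate : ∀ {n} (h : Fin n → ℕ) → sum (tabulate h) ≡ ∑[ j < n ] h j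
sum-tabulate {zero}  h = refl
sum-tabulate {suc n} h = cong (h zero +_) (sum-tabulate (h ∘ suc))

sum-allFin : ∀ {n} (h : Fin n → ℕ) → sum (map h (allFin n)) ≡ ∑[ j < n ] h j
sum-allFin h = trans (cong sum (map-tabulate id h)) (sum-tabulate h)

sum-cartesianProduct : ∀ {A B : Set} (xs : List A) (ys : List B) (h : A × B → ℕ) →
  sum (map h (cartesianProduct xs ys)) ≡ sum (map (λ x → sum (map (λ y → h (x , y)) ys)) xs)
sum-cartesianProduct []       ys h = refl
sum-cartesianProduct (x ∷ xs) ys h = begin
  sum (map h (map (x ,_) ys ++ cartesianProduct xs ys))
    ≡⟨ cong sum (map-++ h (map (x ,_) ys) _) ⟩
  sum (map h (map (x ,_) ys) ++ map h (cartesianProduct xs ys))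
    ≡⟨ sum-++ (map h (map (x ,_) ys)) _ ⟩
  sum (map h (map (x ,_) ys)) + sum (map h (cartesianProduct xs ys))
    ≡⟨ cong₂ _+_ (cong sum (sym (map-∘ ys))) (sum-cartesianProduct xs ys h) ⟩
  sum (map (λ y → h (x , y)) ys) + sum (map (λ x → sum (map (λ y → h (x , y)) ys)) xs) ∎
  where open ≡-Reasoning

sum-vertices : ∀ {m n} (h : Vertex m n → ℕ) →
  sum (map h (vertices m n)) ≡ ∑[ i < m ] ∑[ j < n ] h (i , j)
sum-vertices {m} {n} h = begin
  sum (map h (vertices m n))
    ≡⟨ sum-cartesianProduct (allFin m) (allFin n) h ⟩
  sum (map (λ i → sum (map (λ j → h (i , j)) (allFin n))) (allFin m))
    ≡⟨ cong sum (map-cong (λ i → sum-allFin (λ j → h (i , j))) (allFin m)) ⟩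
  sum (map (λ i → ∑[ j < n ] h (i , j)) (allFin m))
    ≡⟨ sum-allFin (λ i → ∑[ j < n ] h (i , j)) ⟩
  ∑[ i < m ] ∑[ j < n ] h (i , j) ∎
  where open ≡-Reasoning

if-∧ : ∀ x y (c : ℕ) → (if x ∧ y then c else 0) ≡ (if x then (if y then c else 0) else 0)
if-∧ true  y c = refl
if-∧ false y c = refl

if-∨ : ∀ x y (c : ℕ) → (x ≡ true → y ≡ false) →
  (if x ∨ y then c else 0) ≡ (if x then c else 0) + (if y then c else 0)
if-∨ true  y c x⇒¬y rewrite x⇒¬y refl = sym (+-identityʳ c)
if-∨ false y c _ = refl

∑-if : ∀ {n} x (h : Fin n → ℕ) →
  ∑[ j < n ] (if x then h j else 0) ≡ (if x then ∑[ j < n ] h j else 0)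
∑-if {n} true  h = refl
∑-if {n} false h = sum-replicate-zero n

∑-δ : ∀ {n} (j : Fin n) (h : Fin n → ℕ) →
  ∑[ j' < n ] (if ⌊ j ≟ j' ⌋ then h j' else 0) ≡ h j
∑-δ {suc n} zero    h = trans (cong (h zero +_) (sum-replicate-zero n)) (+-identityʳ (h zero))
∑-δ {suc n} (suc j) h =
  trans (sum-cong-≗ (λ j' → cong (λ x → if x then h (suc j') else 0) (⌊suc≟suc⌋ j j')))
        (∑-δ j (h ∘ suc))
  where
  -- not definitional, as _≟_ on successors goes through Dec's map′
  ⌊suc≟suc⌋ : ∀ {n} (j j' : Fin n) → ⌊ suc j ≟ suc j' ⌋ ≡ ⌊ j ≟ j' ⌋
  ⌊suc≟suc⌋ j j' with j ≟ j'
  ... | yes _ = refl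
  ... | no _  = refl

1+n≡ᵇn : ∀ n → (suc n ≡ᵇ n) ≡ false
1+n≡ᵇn zero    = refl
1+n≡ᵇn (suc n) = 1+n≡ᵇn n

cycAdj-irrefl : ∀ m a → cycAdj (2 + m) a a ≡ false
cycAdj-irrefl m zero    = refl
cycAdj-irrefl m (suc a) rewrite 1+n≡ᵇn a | ∧-zeroʳ (a ≡ᵇ m) = refl

pathNbSum : ℕ → (ℕ → ℕ) → ℕ → ℕ
pathNbSum n H s = ∑[ t < n ] (if pathAdj s (toℕ t) then H (toℕ t) else 0)

nbSum-columnwise : ∀ {m n} (H : ℕ → ℕ) (i : Fin (2 + m)) (j : Fin n) →
  nbSum (H ∘ toℕ ∘ proj₂) (i , j) ≡
  pathNbSum n H (toℕ j)
  + ∑[ i' < 2 + m ] (if cycAdj (2 + m) (toℕ i) (toℕ i') then H (toℕ j) else 0)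
nbSum-columnwise {m} {n} H i j = begin
  nbSum (H ∘ toℕ ∘ proj₂) (i , j)
    ≡⟨ sum-vertices (λ u → if adj (i , j) u then H (toℕ (proj₂ u)) else 0) ⟩
  ∑[ i' < 2 + m ] ∑[ j' < n ] (if adj (i , j) (i' , j') then h j' else 0)
    ≡⟨ sum-cong-≗ (λ i' → sum-cong-≗ (λ j' → if-∨ _ _ (h j') (disjoint i' j'))) ⟩
  ∑[ i' < 2 + m ] ∑[ j' < n ] (along-path i' j' + along-cycle i' j')
    ≡⟨ sum-cong-≗ (λ i' → ∑-distrib-+ (along-path i') (along-cycle i')) ⟩
  ∑[ i' < 2 + m ] (∑[ j' < n ] along-path i' j' + ∑[ j' < n ] along-cycle i' j')
    ≡⟨ ∑-distrib-+ (λ i' → ∑[ j' < n ] along-path i' j')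
                   (λ i' → ∑[ j' < n ] along-cycle i' j') ⟩
  ∑[ i' < 2 + m ] ∑[ j' < n ] along-path i' j'
  + ∑[ i' < 2 + m ] ∑[ j' < n ] along-cycle i' j'
    ≡⟨ cong₂ _+_ path-part (sum-cong-≗ cycle-part) ⟩
  pathNbSum n H (toℕ j) + ∑[ i' < 2 + m ] (if c i' then h j else 0) ∎
  where
  open ≡-Reasoning
  h : Fin n → ℕ
  h = H ∘ toℕ
  p : Fin n → Bool
  p j' = pathAdj (toℕ j) (toℕ j')
  c : Fin (2 + m) → Bool
  c i' = cycAdj (2 + m) (toℕ i) (toℕ i')
  along-path along-cycle : Fin (2 + m) → Fin n → ℕ
  along-path  i' j' = if ⌊ i ≟ i' ⌋ ∧ p j' then h j' else 0
  along-cycle i' j' = if ⌊ j ≟ j' ⌋ ∧ c i' then h j' else 0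

  disjoint : ∀ i' j' → ⌊ i ≟ i' ⌋ ∧ p j' ≡ true → ⌊ j ≟ j' ⌋ ∧ c i' ≡ false
  disjoint i' j' with i ≟ i'
  ... | yes refl =
    λ _ → trans (cong (⌊ j ≟ j' ⌋ ∧_) (cycAdj-irrefl m (toℕ i))) (∧-zeroʳ ⌊ j ≟ j' ⌋)
  ... | no _     = λ ()

  path-part : ∑[ i' < 2 + m ] ∑[ j' < n ] along-path i' j' ≡ pathNbSum n H (toℕ j)
  path-part = begin
    ∑[ i' < 2 + m ] ∑[ j' < n ] along-path i' j'
      ≡⟨ sum-cong-≗ (λ i' → trans (sum-cong-≗ (λ j' → if-∧ ⌊ i ≟ i' ⌋ (p j') (h j')))
                                   (∑-if ⌊ i ≟ i' ⌋ (λ j' → if p j' then h j' else 0))) ⟩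
    ∑[ i' < 2 + m ] (if ⌊ i ≟ i' ⌋ then pathNbSum n H (toℕ j) else 0)
      ≡⟨ ∑-δ i (λ _ → pathNbSum n H (toℕ j)) ⟩
    pathNbSum n H (toℕ j) ∎

  cycle-part : ∀ i' → ∑[ j' < n ] along-cycle i' j' ≡ (if c i' then h j else 0)
  cycle-part i' = begin
    ∑[ j' < n ] along-cycle i' j'
      ≡⟨ sum-cong-≗ (λ j' →
           trans (cong (λ x → if x then h j' else 0) (∧-comm ⌊ j ≟ j' ⌋ (c i')))
                 (if-∧ (c i') ⌊ j ≟ j' ⌋ (h j'))) ⟩
    ∑[ j' < n ] (if c i' then (if ⌊ j ≟ j' ⌋ then h j' else 0) else 0)
      ≡⟨ ∑-if (c i') (λ j' → if ⌊ j ≟ j' ⌋ then h j' else 0) ⟩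
    (if c i' then ∑[ j' < n ] (if ⌊ j ≟ j' ⌋ then h j' else 0) else 0)
      ≡⟨ cong (λ x → if c i' then x else 0) (∑-δ j h) ⟩
    (if c i' then h j else 0) ∎

cycleDegree-C₅ : ∀ (i : Fin 5) x →
  ∑[ i' < 5 ] (if cycAdj 5 (toℕ i) (toℕ i') then x else 0) ≡ 2 * x
cycleDegree-C₅ zero                         x = refl
cycleDegree-C₅ (suc zero)                   x = refl
cycleDegree-C₅ (suc (suc zero))             x = refl
cycleDegree-C₅ (suc (suc (suc zero)))       x = refl
cycleDegree-C₅ (suc (suc (suc (suc zero)))) x = refl

nbSum-columnwise-C₅ : ∀ {n} (H : ℕ → ℕ) (i : Fin 5) (j : Fin n) →
  nbSum (H ∘ toℕ ∘ proj₂) (i , j) ≡ pathNbSum n H (toℕ j) + 2 * H (toℕ j)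
nbSum-columnwise-C₅ {n} H i j =
  trans (nbSum-columnwise H i j)
        (cong (pathNbSum n H (toℕ j) +_) (cycleDegree-C₅ i (H (toℕ j))))

nbActive-positive : ∀ {m n} (f : Vertex m n → ℕ) → (∀ u → 0 < f u) →
  ∀ v → nbActive f v ≡ nbSum (λ _ → 1) v
nbActive-positive {m} {n} f f>0 v = cong sum (map-cong active≡adjacent (vertices m n))
  where
  active≡adjacent : ∀ u →
    (if adj v u ∧ (0 <ᵇ f u) then 1 else 0) ≡ (if adj v u then 1 else 0)
  active≡adjacent u = cong (if_then 1 else 0)
    (trans (cong (adj v u ∧_) (Equivalence.to T-≡ (<⇒<ᵇ (f>0 u)))) (∧-identityʳ (adj v u)))

columnwise-isKRDF : ∀ k n (H : ℕ → ℕ) → (∀ s → 0 < H s) → (∀ s → H s ≤ suc k) →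
  (∀ s → s < n → k + (2 + pathNbSum n (λ _ → 1) s) ≤ 3 * H s + pathNbSum n H s) →
  IsKRDF k 5 n (H ∘ toℕ ∘ proj₂)
columnwise-isKRDF k n H H>0 H≤1+k closedNbhd = (λ v → H≤1+k _) , λ { (i , j) _ → krdf i j }
  where
  f : Vertex 5 n → ℕ
  f = H ∘ toℕ ∘ proj₂
  krdf : ∀ i j → k + nbActive f (i , j) ≤ f (i , j) + nbSum f (i , j)
  krdf i j = begin
    k + nbActive f (i , j)
      ≡⟨ cong (k +_) (trans (nbActive-positive f (H>0 ∘ toℕ ∘ proj₂) (i , j))
                            (nbSum-columnwise-C₅ (λ _ → 1) i j)) ⟩
    k + (pathNbSum n (λ _ → 1) s + 2)
      ≡⟨ cong (k +_) (+-comm (pathNbSum n (λ _ → 1) s) 2) ⟩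
    k + (2 + pathNbSum n (λ _ → 1) s)
      ≤⟨ closedNbhd s (toℕ<n j) ⟩
    3 * H s + pathNbSum n H s
      ≡⟨ regroup (H s) (pathNbSum n H s) ⟩
    H s + (pathNbSum n H s + 2 * H s)
      ≡⟨ cong (H s +_) (nbSum-columnwise-C₅ H i j) ⟨
    f (i , j) + nbSum f (i , j) ∎
    where
    open ≤-Reasoning
    s : ℕ
    s = toℕ j
    regroup : ∀ x y → 3 * x + y ≡ x + (y + 2 * x)
    regroup = solve-∀

pathNbSum-first : ∀ n H → pathNbSum (2 + n) H 0 ≡ H 1
pathNbSum-first n H = trans (cong (H 1 +_) (sum-replicate-zero n)) (+-identityʳ (H 1))

pathNbSum-last : ∀ s H → pathNbSum (2 + s) H (suc s) ≡ H s
pathNbSum-last zero    H = +-identityʳ (H 0)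
pathNbSum-last (suc s) H = pathNbSum-last s (H ∘ suc)

pathNbSum-inner : ∀ {n} s H → 2 + s < n → pathNbSum n H (suc s) ≡ H s + H (2 + s)
pathNbSum-inner {2}                 zero    H (s≤s (s≤s ()))
pathNbSum-inner {suc (suc (suc n))} zero    H _           =
  cong (H 0 +_) (pathNbSum-first n (H ∘ suc))
pathNbSum-inner {suc n}             (suc s) H (s≤s 2+s<n) =
  pathNbSum-inner s (H ∘ suc) 2+s<n

columnProfile : (N a b : ℕ) → ℕ → ℕ
columnProfile N a b zero    = b
columnProfile N a b (suc t) = if t <ᵇ N then a else b

module _ {N a b : ℕ} where

  columnProfile-elim : (P : ℕ → Set) → P a → P b → ∀ t → P (columnProfile N a b t)
  columnProfile-elim P Pa Pb zero = Pb
  columnProfile-elim P Pa Pb (suc t) with t <ᵇ N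
  ... | true  = Pa
  ... | false = Pb

  columnProfile-inner : ∀ {t} → 0 < t → t ≤ N → columnProfile N a b t ≡ a
  columnProfile-inner {suc t} _ t<N =
    cong (if_then a else b) (Equivalence.to T-≡ (<⇒<ᵇ t<N))

  columnProfile-neighbours : 2 ≤ N → ∀ {t} → t < N →
    a + a ⊓ b ≤ columnProfile N a b t + columnProfile N a b (2 + t)
  columnProfile-neighbours 2≤N {zero} _ = begin
    a + a ⊓ b ≤⟨ +-monoʳ-≤ a (m⊓n≤n a b) ⟩
    a + b     ≡⟨ +-comm a b ⟩
    b + a     ≡⟨ cong (b +_) (columnProfile-inner z<s 2≤N) ⟨
    b + columnProfile N a b 2 ∎
    where open ≤-Reasoning
  columnProfile-neighbours 2≤N {suc t} t<N = begin
    a + a ⊓ b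
      ≤⟨ +-monoʳ-≤ a (columnProfile-elim (a ⊓ b ≤_) (m⊓n≤m a b) (m⊓n≤n a b) (3 + t)) ⟩
    a + columnProfile N a b (3 + t)
      ≡⟨ cong (_+ columnProfile N a b (3 + t)) (columnProfile-inner z<s (<⇒≤ t<N)) ⟨
    columnProfile N a b (suc t) + columnProfile N a b (3 + t) ∎
    where open ≤-Reasoning

  columnProfile-last : columnProfile N a b (suc N) ≡ b
  columnProfile-last = cong (if_then a else b) (n<ᵇn N)
    where
    n<ᵇn : ∀ n → (n <ᵇ n) ≡ false
    n<ᵇn zero    = refl
    n<ᵇn (suc n) = n<ᵇn n

∑-columnProfile : ∀ N a b → ∑[ t < 2 + N ] columnProfile N a b (toℕ t) ≡ b + (N * a + b)
∑-columnProfile N a b = cong (b +_) (interior-and-last N)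
  where
  interior-and-last : ∀ N → ∑[ t < suc N ] (if toℕ t <ᵇ N then a else b) ≡ N * a + b
  interior-and-last zero    = +-identityʳ b
  interior-and-last (suc N) =
    trans (cong (a +_) (interior-and-last N)) (sym (+-assoc a (N * a) b))

weight-columnProfile : ∀ N a b →
  weight {5} {2 + N} (columnProfile N a b ∘ toℕ ∘ proj₂) ≡ 5 * N * a + 10 * b
weight-columnProfile N a b = begin
  weight {5} {2 + N} (columnProfile N a b ∘ toℕ ∘ proj₂)
    ≡⟨ sum-vertices {5} {2 + N} (columnProfile N a b ∘ toℕ ∘ proj₂) ⟩
  5 * ∑[ t < 2 + N ] columnProfile N a b (toℕ t)
    ≡⟨ cong (5 *_) (∑-columnProfile N a b) ⟩
  5 * (b + (N * a + b))
    ≡⟨ solve (N ∷ a ∷ b ∷ []) ⟩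
  5 * N * a + 10 * b ∎
  where open ≡-Reasoning

record WeightBounds (k a b : ℕ) : Set where
  field
    5a-lower   : k + 4 ≤ 5 * a
    5a-upper   : 5 * a ≤ k + 8
    3b+a-lower : k + 3 ≤ 3 * b + a
    3b+a-upper : 3 * b + a ≤ k + 5

ceiling-weightBounds : ∀ k → WeightBounds k ⌈ k + 4 / 5 ⌉ ⌈ k + 3 ∸ ⌈ k + 4 / 5 ⌉ / 3 ⌉
ceiling-weightBounds k = record
  { 5a-lower   = m≤n*⌈m/n⌉ (k + 4) 5
  ; 5a-upper   = 5a≤k+8
  ; 3b+a-lower = begin
      k + 3     ≡⟨ c+a≡k+3 ⟨
      c + a     ≤⟨ +-monoˡ-≤ a (m≤n*⌈m/n⌉ c 3) ⟩
      3 * b + a ∎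
  ; 3b+a-upper = begin
      3 * b + a     ≤⟨ +-monoˡ-≤ a (n*⌈m/n⌉≤m+n∸1 c 3) ⟩
      c + 3 ∸ 1 + a ≡⟨ cong (_+ a) (+-∸-assoc c {3} (s≤s z≤n)) ⟩
      c + 2 + a     ≡⟨ +-comm (c + 2) a ⟩
      a + (c + 2)   ≡⟨ +-assoc a c 2 ⟨
      a + c + 2     ≡⟨ cong (_+ 2) (trans (+-comm a c) c+a≡k+3) ⟩
      k + 3 + 2     ≡⟨ +-assoc k 3 2 ⟩
      k + 5         ∎
  }
  where
  open ≤-Reasoning
  a c b : ℕ
  a = ⌈ k + 4 / 5 ⌉
  c = k + 3 ∸ a
  b = ⌈ c / 3 ⌉
  5a≤k+8 : 5 * a ≤ k + 8
  5a≤k+8 = subst (5 * a ≤_) (trans (cong (_∸ 1) (+-assoc k 4 5)) (+-∸-assoc k {9} (s≤s z≤n)))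
                 (n*⌈m/n⌉≤m+n∸1 (k + 4) 5)
  c+a≡k+3 : c + a ≡ k + 3
  c+a≡k+3 = m∸n+n≡m (*-cancelˡ-≤ {a} {k + 3} 5
              (≤-trans 5a≤k+8 (≤-offset (4 * k + 7) (solve (k ∷ [])))))

module _ {k a b : ℕ} (w : WeightBounds k a b) where
  open WeightBounds w
  open ≤-Reasoning

  a-positive : 0 < a
  a-positive = *-cancelˡ-< 5 0 a (<-≤-trans z<s (≤-trans (m≤n+m 4 k) 5a-lower))

  a≤1+k : a ≤ suc k
  a≤1+k = ≤-pred (*-cancelˡ-< 5 a (2 + k)
            (s≤s (≤-trans 5a-upper (≤-offset (4 * k + 1) (solve (k ∷ []))))))

  b-positive : 0 < b
  b-positive = *-cancelˡ-< 3 0 b (+-cancelʳ-< a 0 (3 * b) (begin-strict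
    a         ≤⟨ a≤1+k ⟩
    suc k     <⟨ ≤-offset 1 (solve (k ∷ [])) ⟩
    k + 3     ≤⟨ 3b+a-lower ⟩
    3 * b + a ∎))

  b≤1+k : b ≤ suc k
  b≤1+k = ≤-pred (*-cancelˡ-< 3 b (2 + k) (begin-strict
    3 * b       <⟨ m<m+n (3 * b) a-positive ⟩
    3 * b + a   ≤⟨ 3b+a-upper ⟩
    k + 5       ≤⟨ ≤-offset (2 * k + 1) (solve (k ∷ [])) ⟩
    3 * (2 + k) ∎))

  4a+b-lower : k + 4 ≤ 4 * a + b
  4a+b-lower = *-cancelˡ-≤ 3 (begin
    3 * (k + 4)
      ≡⟨ solve (k ∷ []) ⟩
    (k + 3) + 2 * (k + 4) + 1
      ≤⟨ +-mono-≤ (+-mono-≤ 3b+a-lower (*-monoʳ-≤ 2 5a-lower)) a-positive ⟩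
    (3 * b + a) + 2 * (5 * a) + a
      ≡⟨ solve (a ∷ b ∷ []) ⟩
    3 * (4 * a + b) ∎)

  4a+a⊓b-lower : k + 4 ≤ 4 * a + a ⊓ b
  4a+a⊓b-lower = begin
    k + 4
      ≤⟨ ⊓-glb (≤-trans 5a-lower (≤-reflexive (+-comm a (4 * a)))) 4a+b-lower ⟩
    (4 * a + a) ⊓ (4 * a + b)
      ≡⟨ +-distribˡ-⊓ (4 * a) a b ⟨
    4 * a + a ⊓ b ∎

  bound-estimate : ∀ N → 3 * (5 * N * a + 10 * b) + 2 ≤ 3 * (2 + N) * k + 27 * (2 + N) + 2 * k
  bound-estimate N = +-cancelʳ-≤ (10 * a) _ _ (begin
    3 * (5 * N * a + 10 * b) + 2 + 10 * a
      ≡⟨ solve (N ∷ a ∷ b ∷ []) ⟩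
    3 * N * (5 * a) + 10 * (3 * b + a) + 2
      ≤⟨ +-monoˡ-≤ 2 (+-mono-≤ (*-monoʳ-≤ (3 * N) 5a-upper) (*-monoʳ-≤ 10 3b+a-upper)) ⟩
    3 * N * (k + 8) + 10 * (k + 5) + 2
      ≤⟨ ≤-offset (3 * N + 10) (solve (N ∷ k ∷ [])) ⟩
    3 * (2 + N) * k + 27 * (2 + N) + 2 * k + 2 * (k + 4)
      ≤⟨ +-monoʳ-≤ rhs (*-monoʳ-≤ 2 5a-lower) ⟩
    rhs + 2 * (5 * a)
      ≡⟨ cong (rhs +_) (sym (*-assoc 2 5 a)) ⟩
    rhs + 10 * a ∎)
    where
    rhs : ℕ
    rhs = 3 * (2 + N) * k + 27 * (2 + N) + 2 * k

  columnProfile-closedNbhd : ∀ N → 2 ≤ N → ∀ s → s < 2 + N →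
    k + (2 + pathNbSum (2 + N) (λ _ → 1) s)
      ≤ 3 * columnProfile N a b s + pathNbSum (2 + N) (columnProfile N a b) s
  columnProfile-closedNbhd N 2≤N zero _
    rewrite pathNbSum-first N (λ _ → 1) | pathNbSum-first N (columnProfile N a b)
          | columnProfile-inner {N} {a} {b} z<s (<⇒≤ 2≤N)
    = 3b+a-lower
  columnProfile-closedNbhd N 2≤N (suc s) s<2+N with m<1+n⇒m<n∨m≡n (s≤s⁻¹ s<2+N)
  ... | inj₂ refl
    rewrite pathNbSum-last s (λ _ → 1) | pathNbSum-last s (columnProfile s a b)
          | columnProfile-last {s} {a} {b}
          | columnProfile-inner {s} {a} {b} (<-≤-trans z<s 2≤N) ≤-refl
    = 3b+a-lower
  ... | inj₁ s<N
    rewrite pathNbSum-inner s (λ _ → 1) (s≤s (s≤s s<N))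
          | pathNbSum-inner s (columnProfile N a b) (s≤s (s≤s s<N))
          | columnProfile-inner {N} {a} {b} z<s s<N
    = begin
    k + 4                 ≤⟨ 4a+a⊓b-lower ⟩
    4 * a + a ⊓ b         ≡⟨ regroup a (a ⊓ b) ⟩
    3 * a + (a + a ⊓ b)   ≤⟨ +-monoʳ-≤ (3 * a) (columnProfile-neighbours 2≤N s<N) ⟩
    3 * a + (columnProfile N a b s + columnProfile N a b (2 + s)) ∎
    where
    regroup : ∀ x y → 4 * x + y ≡ 3 * x + (x + y)
    regroup = solve-∀

theorem5 : (n k : ℕ) → 4 ≤ n → 1 ≤ k →
    (γ[ k ]R-C 5 □P n ≤ bound5 n k) × (3 * bound5 n k + 2 ≤ 3 * n * k + 27 * n + 2 * k)
theorem5 (suc (suc N)) k (s≤s (s≤s 2≤N)) _ =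
  (f , isKRDF , ≤-reflexive (weight-columnProfile N a b)) , bound-estimate w N
  where
  a b : ℕ
  a = ⌈ k + 4 / 5 ⌉
  b = ⌈ k + 3 ∸ a / 3 ⌉
  w : WeightBounds k a b
  w = ceiling-weightBounds k
  G : ℕ → ℕ
  G = columnProfile N a b
  f : Vertex 5 (2 + N) → ℕ
  f = G ∘ toℕ ∘ proj₂

  isKRDF : IsKRDF k 5 (2 + N) f
  isKRDF = columnwise-isKRDF k (2 + N) G
    (columnProfile-elim (0 <_) (a-positive w) (b-positive w))
    (columnProfile-elim (_≤ suc k) (a≤1+k w) (b≤1+k w))
    (columnProfile-closedNbhd w N 2≤N)
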